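{- Let $G$ be a graph with maximum degree $d$ on $p\ge 2^{d+1}$ nodes (with $p$ larger than a suitable universal constant), and consider the hard-core model on $G$ with canonical parameters $\theta=\mathbf 0$. Then the corresponding vector of mean parameters $\mu(\mathbf 0)$ lies in $\mathcal{M}_1=\{\mu\in\mathcal{M}\cap[q\epsilon,\infty)^p:\ \mu+\epsilon e_i\in\mathcal{M}\text{ for all } i\}$, where $\epsilon=p^{ -8}$, $q=p^5$.
   Context: $V=\{1,\dots,p\}$; $\mathcal{I}(G)\subseteq\{0,1\}^V$ are indicator vectors of independent sets; the hard-core model with $\theta=\mathbf 0$ is the uniform distribution on $\mathcal{I}(G)$ and $\mu_i(\mathbf 0)$ is the probability that $i$ belongs to the random independent set. $\mathcal{M}$ is the convex hull of $\mathcal{I}(G)$ (marginal polytope) and $e_i$ is the $i$-th standard basis vector. -}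

module Defs where

open import Data.Bool using (Bool; true; false; _∧_; not; if_then_else_)
open import Data.Nat as ℕ using (ℕ; zero; suc; _⊔_)
open import Data.Fin using (Fin)
open import Data.Vec using (Vec; []; _∷_; lookup)
open import Data.List as List using (List; []; _∷_; _++_; map; filter; length; foldr; allFin)
open import Data.Integer using (+_)
open import Data.Rational as ℚ using (ℚ; 0ℚ; 1ℚ; _+_; _*_; _≤_; _/_)
open import Relation.Binary.PropositionalEquality using (_≡_)
open import Relation.Nullary.Decidable using (yes; no)
open import Data.Bool using (_≟_)

record Graph (p : ℕ) : Set where
  field
    adj    : Fin p → Fin p → Bool
    sym    : ∀ i j → adj i j ≡ adj j i
    irrefl : ∀ i → adj i i ≡ false
open Graph public

count : ∀ {n} → (Fin n → Bool) → ℕ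
count {n} f = length (filter (λ i → f i ≟ true) (allFin n))

degree : ∀ {p} → Graph p → Fin p → ℕ
degree G i = count (adj G i)

maxDegree : ∀ {p} → Graph p → ℕ
maxDegree {p} G = foldr _⊔_ 0 (map (degree G) (allFin p))

allVecs : (n : ℕ) → List (Vec Bool n)
allVecs zero = [] ∷ []
allVecs (suc n) = map (false ∷_) (allVecs n) ++ map (true ∷_) (allVecs n)

isIndep : ∀ {p} → Graph p → Vec Bool p → Bool
isIndep {p} G x =
  foldr _∧_ true
    (map (λ i → foldr _∧_ true
                  (map (λ j → not (adj G i j ∧ lookup x i ∧ lookup x j)) (allFin p)))
         (allFin p))

indepSets : ∀ {p} → Graph p → List (Vec Bool p)
indepSets {p} G = filter (λ x → isIndep G x ≟ true) (allVecs p)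

-- a / b as a rational (b = 0 never occurs below since ∅ ∈ 𝓘(G)).
frac : ℕ → ℕ → ℚ
frac a zero = 0ℚ
frac a (suc b) = (+ a) / suc b

b2q : Bool → ℚ
b2q true = 1ℚ
b2q false = 0ℚ

sumℚ : List ℚ → ℚ
sumℚ = foldr _+_ 0ℚ

-- Mean parameters of the hard-core model with θ = 0 (uniform on 𝓘(G)):
-- μ_i(0) = P(i ∈ random independent set).
meanParam0 : ∀ {p} → Graph p → Fin p → ℚ
meanParam0 G i =
  frac (length (filter (λ x → lookup x i ≟ true) (indepSets G)))
       (length (indepSets G))

-- Marginal polytope 𝓜 = conv 𝓘(G): μ is a convex combination of the
-- indicator vectors of independent sets (weights indexed by 𝓘(G)).
InMarginalPolytope : ∀ {p} → Graph p → (Fin p → ℚ) → Set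
InMarginalPolytope {p} G μ =
  Data.Product.Σ (Vec Bool p → ℚ) λ w →
    (∀ x → 0ℚ ≤ w x) Data.Product.×
    (sumℚ (map w (indepSets G)) ≡ 1ℚ) Data.Product.×
    (∀ i → sumℚ (map (λ x → w x * b2q (lookup x i)) (indepSets G)) ≡ μ i)
  where import Data.Product

addAt : ∀ {p} → (Fin p → ℚ) → ℚ → Fin p → Fin p → ℚ
addAt {p} μ c i j with Data.Fin._≟_ j i
... | yes _ = μ j + c
... | no _ = μ j

InM1 : ∀ {p} → Graph p → (ε q : ℚ) → (Fin p → ℚ) → Set
InM1 {p} G ε q μ =
  InMarginalPolytope G μ Data.Product.×
  (∀ i → q * ε ≤ μ i) Data.Product.×
  (∀ i → InMarginalPolytope G (addAt μ ε i))
  where import Data.Product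

powℚ : ℕ → ℕ → ℚ
powℚ p k = frac (p ℕ.^ k) 1

invPowℚ : ℕ → ℕ → ℚ
invPowℚ p k = frac 1 (p ℕ.^ k)

module Submission where

-- Write N = |𝓘(G)| and Aᵢ = #{x ∈ 𝓘(G) : i ∈ x}, so that μᵢ(0) = Aᵢ/N.
--
-- (1) Counting bound N ≤ 2^(deg i + 1)·Aᵢ ≤ p·Aᵢ.  Independent sets form a
--     down-closed family in the Boolean cube, and a down-closed family loses at
--     most half of its members when one coordinate is forced to 0 (halving).
--     Forcing the deg i neighbours of i to 0 costs a factor 2^(deg i).  The
--     independent sets avoiding every neighbour of i stay independent when i is
--     toggled, so at most half of them miss i: one more factor 2.
-- (2) μ(0) ∈ 𝓜 through the uniform weights 1/N, and μᵢ(0) = Aᵢ/N ≥ 1/p ≥ p⁻³ = qε.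
-- (3) μ(0) + εeᵢ ∈ 𝓜: every x ∌ i with x ∪ {i} independent hands the mass
--     c = ε/Aᵢ over to x ∪ {i}.  The i-th marginal grows by c·Aᵢ = ε, the other
--     marginals are unchanged, and the weights stay nonnegative since c ≤ 1/N,
--     i.e. N ≤ p⁸·Aᵢ, which follows from (1).

module HardCore where

  open import Data.Bool using (Bool; true; false; _∧_; not; _≟_)
  open import Data.Bool.Properties
    using (∧-assoc; ∧-conicalˡ; ∧-conicalʳ; ∧-identityʳ; ∧-zeroʳ; not-involutive; not-injective)
  open import Data.Fin as Fin using (Fin; zero; suc)
  open import Data.Integer as ℤ using (ℤ)
  import Data.Integer.Properties as ℤP
  open import Data.Integer.Tactic.RingSolver using (solve-∀)
  open import Data.List using (List; []; _∷_; _++_; map; filter; foldr; length; allFin)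
  open import Data.List.Membership.Propositional using (_∈_)
  open import Data.List.Membership.Propositional.Properties
    using (∈-allFin; ∈-filter⁺; ∈-map⁺; ∈-++⁺ˡ; ∈-++⁺ʳ)
  open import Data.List.Relation.Unary.Any using (here; there)
  open import Data.Nat as ℕ using (ℕ; zero; suc; _⊔_; _^_)
  import Data.Nat.Properties as ℕP
  open import Data.Nat.Coprimality using (1-coprimeTo) renaming (sym to coprime-sym)
  open import Data.Product using (_,_)
  open import Data.Rational as ℚ using (ℚ; mkℚ; 0ℚ; 1ℚ; _+_; _*_; _-_; -_; _≤_)
  open import Data.Rational.Properties hiding (_≟_)
  import Data.Rational.Unnormalised as ℚᵘ
  import Data.Rational.Unnormalised.Properties as ℚᵘP
  open import Data.Rational.Solver using (module +-*-Solver)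
  open import Data.Vec using (Vec; []; _∷_; lookup; replicate)
  open import Data.Vec.Properties using (lookup-replicate)
  open import Function using (_∘_)
  open import Relation.Binary.PropositionalEquality
    using (_≡_; _≢_; refl; sym; trans; cong; cong₂; subst; subst₂; module ≡-Reasoning)
  open import Relation.Nullary using (yes; no; contradiction)
  open import Defs hiding (sym)

  module Fractions where

    open import Data.Integer using (+_)

    ι : ℕ → ℚ
    ι n = mkℚ (+ n) 0 (coprime-sym (1-coprimeTo n))

    ι-nonNeg : ∀ n → ℚ.NonNegative (ι n)
    ι-nonNeg n = _

    ι-positive : ∀ n .{{_ : ℕ.NonZero n}} → ℚ.Positive (ι n)
    ι-positive (suc n) = _

    ι-+ : ∀ m n → ι (m ℕ.+ n) ≡ ι m + ι n
    ι-+ m n = toℚᵘ-injective (ℚᵘP.≃-trans (ℚᵘ.*≡* numerators) (ℚᵘP.≃-sym (toℚᵘ-homo-+ (ι m) (ι n))))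
      where
      normalise : ∀ a b → a ℤ.+ b ≡ (a ℤ.* + 1 ℤ.+ b ℤ.* + 1) ℤ.* + 1
      normalise = solve-∀
      numerators : + (m ℕ.+ n) ℤ.* + 1 ≡ (+ m ℤ.* + 1 ℤ.+ + n ℤ.* + 1) ℤ.* + 1
      numerators = trans (ℤP.*-identityʳ _) (trans (ℤP.pos-+ m n) (normalise (+ m) (+ n)))

    ι-* : ∀ m n → ι (m ℕ.* n) ≡ ι m * ι n
    ι-* m n = toℚᵘ-injective
      (ℚᵘP.≃-trans (ℚᵘ.*≡* (cong (ℤ._* + 1) (ℤP.pos-* m n))) (ℚᵘP.≃-sym (toℚᵘ-homo-* (ι m) (ι n))))

    ι-mono : ∀ {m n} → m ℕ.≤ n → ι m ≤ ι n
    ι-mono m≤n = ℚ.*≤* (subst₂ ℤ._≤_ (sym (ℤP.*-identityʳ _)) (sym (ℤP.*-identityʳ _)) (ℤ.+≤+ m≤n))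

    ι-reflects-≤ : ∀ {m n} → ι m ≤ ι n → m ℕ.≤ n
    ι-reflects-≤ {m} {n} (ℚ.*≤* le) with subst₂ ℤ._≤_ (ℤP.*-identityʳ (+ m)) (ℤP.*-identityʳ (+ n)) le
    ... | ℤ.+≤+ m≤n = m≤n

    ι-double : ∀ m → ι (2 ^ suc m) ≡ ι (2 ^ m) + ι (2 ^ m)
    ι-double m = trans (cong (λ k → ι (2 ^ m ℕ.+ k)) (ℕP.+-identityʳ (2 ^ m))) (ι-+ (2 ^ m) (2 ^ m))

    cross-multiply : ∀ x a n (g : ℤ) → ℚ.↥ x ℤ.* g ≡ + a → ℚ.↧ x ℤ.* g ≡ + suc n → x * ι (suc n) ≡ ι a
    cross-multiply x@(mkℚ num den _) a n g num≡ den≡ =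
      toℚᵘ-injective (ℚᵘP.≃-trans (toℚᵘ-homo-* x (ι (suc n))) (ℚᵘ.*≡* numerators))
      where
      rearrange : ∀ X Y G → (X ℤ.* (Y ℤ.* G)) ℤ.* + 1 ≡ (X ℤ.* G) ℤ.* (Y ℤ.* + 1)
      rearrange = solve-∀
      numerators : (num ℤ.* + suc n) ℤ.* + 1 ≡ + a ℤ.* (+ suc den ℤ.* + 1)
      numerators = subst₂ (λ u v → (num ℤ.* u) ℤ.* + 1 ≡ v ℤ.* (+ suc den ℤ.* + 1)) den≡ num≡
                          (rearrange num (+ suc den) g)

    frac-*-denominator : ∀ a b .{{_ : ℕ.NonZero b}} → frac a b * ι b ≡ ι a
    frac-*-denominator a (suc b) =
      cross-multiply (frac a (suc b)) a b _ (↥-/ (+ a) (suc b)) (↧-/ (+ a) (suc b))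

    *-cancelʳ-≡-pos : ∀ {x y} r .{{_ : ℚ.Positive r}} → x * r ≡ y * r → x ≡ y
    *-cancelʳ-≡-pos r eq = ≤-antisym (*-cancelʳ-≤-pos r (≤-reflexive eq)) (*-cancelʳ-≤-pos r (≤-reflexive (sym eq)))

    frac-unique : ∀ {x} a b .{{_ : ℕ.NonZero b}} → x * ι b ≡ ι a → x ≡ frac a b
    frac-unique a b eq = *-cancelʳ-≡-pos (ι b) {{ι-positive b}} (trans eq (sym (frac-*-denominator a b)))

    frac-one : ∀ a → frac a 1 ≡ ι a
    frac-one a = sym (frac-unique a 1 (*-identityʳ (ι a)))

    reciprocal-* : ∀ a b .{{_ : ℕ.NonZero b}} → frac 1 b * ι a ≡ frac a b
    reciprocal-* a b = frac-unique a b (begin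
        frac 1 b * ι a * ι b    ≡⟨ *-assoc (frac 1 b) (ι a) (ι b) ⟩
        frac 1 b * (ι a * ι b)  ≡⟨ cong (frac 1 b *_) (*-comm (ι a) (ι b)) ⟩
        frac 1 b * (ι b * ι a)  ≡⟨ sym (*-assoc (frac 1 b) (ι b) (ι a)) ⟩
        frac 1 b * ι b * ι a    ≡⟨ cong (_* ι a) (frac-*-denominator 1 b) ⟩
        1ℚ * ι a                ≡⟨ *-identityˡ (ι a) ⟩
        ι a                     ∎)
      where open ≡-Reasoning

    reciprocal-cancel : ∀ a b .{{_ : ℕ.NonZero a}} .{{_ : ℕ.NonZero b}} → frac 1 (b ℕ.* a) * ι a ≡ frac 1 b
    reciprocal-cancel a b = frac-unique 1 b (begin
        x * ι a * ι b           ≡⟨ *-assoc x (ι a) (ι b) ⟩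
        x * (ι a * ι b)         ≡⟨ cong (x *_) (trans (*-comm (ι a) (ι b)) (sym (ι-* b a))) ⟩
        x * ι (b ℕ.* a)         ≡⟨ frac-*-denominator 1 (b ℕ.* a) {{ℕP.m*n≢0 b a}} ⟩
        1ℚ                      ∎)
      where
      open ≡-Reasoning
      x : ℚ
      x = frac 1 (b ℕ.* a)

    frac-nonneg : ∀ a b → 0ℚ ≤ frac a b
    frac-nonneg a zero = ≤-refl
    frac-nonneg a (suc b) = nonNegative⁻¹ _ {{normalize-nonNeg a (suc b)}}

    frac-≤ : ∀ a b c d .{{_ : ℕ.NonZero b}} .{{_ : ℕ.NonZero d}} → a ℕ.* d ℕ.≤ c ℕ.* b → frac a b ≤ frac c d
    frac-≤ a b c d ad≤cb = *-cancelʳ-≤-pos (ι b * ι d) {{pos*pos⇒pos (ι b) {{ι-positive b}} (ι d) {{ι-positive d}}}} (begin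
        frac a b * (ι b * ι d)  ≡⟨ sym (*-assoc (frac a b) (ι b) (ι d)) ⟩
        frac a b * ι b * ι d    ≡⟨ cong (_* ι d) (frac-*-denominator a b) ⟩
        ι a * ι d               ≡⟨ sym (ι-* a d) ⟩
        ι (a ℕ.* d)             ≤⟨ ι-mono ad≤cb ⟩
        ι (c ℕ.* b)             ≡⟨ ι-* c b ⟩
        ι c * ι b               ≡⟨ cong (_* ι b) (sym (frac-*-denominator c d)) ⟩
        frac c d * ι d * ι b    ≡⟨ *-assoc (frac c d) (ι d) (ι b) ⟩
        frac c d * (ι d * ι b)  ≡⟨ cong (frac c d *_) (*-comm (ι d) (ι b)) ⟩
        frac c d * (ι b * ι d)  ∎)
      where open ≤-Reasoning

  open Fractions

  b2q-nonneg : ∀ b → 0ℚ ≤ b2q b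
  b2q-nonneg true = ≤ᵇ⇒≤ _
  b2q-nonneg false = ≤-refl

  b2q-mono : ∀ {a b} → (a ≡ true → b ≡ true) → b2q a ≤ b2q b
  b2q-mono {true} a⇒b rewrite a⇒b refl = ≤-refl
  b2q-mono {false} {b} a⇒b = b2q-nonneg b

  b2q-∧ : ∀ a b → b2q (a ∧ b) ≡ b2q a * b2q b
  b2q-∧ true b = sym (*-identityˡ (b2q b))
  b2q-∧ false b = sym (*-zeroˡ (b2q b))

  b2q-split : ∀ a c → b2q a ≡ b2q (a ∧ not c) + b2q (a ∧ c)
  b2q-split true true = refl
  b2q-split true false = refl
  b2q-split false true = refl
  b2q-split false false = refl

  b2q-idem : ∀ b → b2q b * b2q b ≡ b2q b
  b2q-idem true = refl
  b2q-idem false = refl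

  b2q-complement : ∀ b → b2q b * b2q (not b) ≡ 0ℚ
  b2q-complement true = refl
  b2q-complement false = refl

  b2q-absorb : ∀ {a b} → (b ≡ true → a ≡ true) → b2q a * b2q b ≡ b2q b
  b2q-absorb {a} {false} b⇒a = *-zeroʳ (b2q a)
  b2q-absorb {a} {true} b⇒a rewrite b⇒a refl = refl

  b2q-difference : ∀ a b → - 1ℚ ≤ b2q a - b2q (b ∧ not a)
  b2q-difference true true = ≤ᵇ⇒≤ _
  b2q-difference true false = ≤ᵇ⇒≤ _
  b2q-difference false true = ≤ᵇ⇒≤ _
  b2q-difference false false = ≤ᵇ⇒≤ _

  ∑ : {A : Set} → List A → (A → ℚ) → ℚ
  ∑ L f = sumℚ (map f L)

  ∑-++ : ∀ {A : Set} (xs ys : List A) f → ∑ (xs ++ ys) f ≡ ∑ xs f + ∑ ys f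
  ∑-++ [] ys f = sym (+-identityˡ (∑ ys f))
  ∑-++ (x ∷ xs) ys f = trans (cong (f x +_) (∑-++ xs ys f)) (sym (+-assoc (f x) _ _))

  ∑-map : ∀ {A B : Set} (g : A → B) L (f : B → ℚ) → ∑ (map g L) f ≡ ∑ L (f ∘ g)
  ∑-map g [] f = refl
  ∑-map g (x ∷ L) f = cong (f (g x) +_) (∑-map g L f)

  ∑-cong : ∀ {A : Set} L {f g : A → ℚ} → (∀ x → f x ≡ g x) → ∑ L f ≡ ∑ L g
  ∑-cong [] f≡g = refl
  ∑-cong (x ∷ L) f≡g = cong₂ _+_ (f≡g x) (∑-cong L f≡g)

  ∑-mono : ∀ {A : Set} L {f g : A → ℚ} → (∀ x → f x ≤ g x) → ∑ L f ≤ ∑ L g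
  ∑-mono [] f≤g = ≤-refl
  ∑-mono (x ∷ L) f≤g = +-mono-≤ (f≤g x) (∑-mono L f≤g)

  ∑-zero : ∀ {A : Set} L {f : A → ℚ} → (∀ x → f x ≡ 0ℚ) → ∑ L f ≡ 0ℚ
  ∑-zero [] f≡0 = refl
  ∑-zero (x ∷ L) f≡0 = trans (cong₂ _+_ (f≡0 x) (∑-zero L f≡0)) (+-identityʳ 0ℚ)

  ∑-+ : ∀ {A : Set} L (f g : A → ℚ) → ∑ L (λ x → f x + g x) ≡ ∑ L f + ∑ L g
  ∑-+ [] f g = refl
  ∑-+ (x ∷ L) f g = trans (cong (f x + g x +_) (∑-+ L f g))
    (solve 4 (λ a b c d → (a :+ b) :+ (c :+ d) := (a :+ c) :+ (b :+ d)) refl (f x) (g x) (∑ L f) (∑ L g))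
    where open +-*-Solver

  ∑-*ˡ : ∀ {A : Set} L c (f : A → ℚ) → ∑ L (λ x → c * f x) ≡ c * ∑ L f
  ∑-*ˡ [] c f = sym (*-zeroʳ c)
  ∑-*ˡ (x ∷ L) c f = trans (cong (c * f x +_) (∑-*ˡ L c f)) (sym (*-distribˡ-+ c (f x) (∑ L f)))

  ∑-neg : ∀ {A : Set} L (f : A → ℚ) → ∑ L (λ x → - f x) ≡ - ∑ L f
  ∑-neg [] f = refl
  ∑-neg (x ∷ L) f = trans (cong (- f x +_) (∑-neg L f)) (sym (neg-distrib-+ (f x) (∑ L f)))

  ∑-- : ∀ {A : Set} L (f g : A → ℚ) → ∑ L (λ x → f x - g x) ≡ ∑ L f - ∑ L g
  ∑-- L f g = trans (∑-+ L f (λ x → - g x)) (cong (∑ L f +_) (∑-neg L g))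

  ∑-const : ∀ {A : Set} (L : List A) c → ∑ L (λ _ → c) ≡ c * ι (length L)
  ∑-const [] c = sym (*-zeroʳ c)
  ∑-const (x ∷ L) c = begin
      c + ∑ L (λ _ → c)            ≡⟨ cong (c +_) (∑-const L c) ⟩
      c + c * ι (length L)         ≡⟨ cong (_+ c * ι (length L)) (sym (*-identityʳ c)) ⟩
      c * 1ℚ + c * ι (length L)    ≡⟨ sym (*-distribˡ-+ c 1ℚ (ι (length L))) ⟩
      c * (1ℚ + ι (length L))      ≡⟨ cong (c *_) (sym (ι-+ 1 (length L))) ⟩
      c * ι (suc (length L))       ∎
    where open ≡-Reasoning

  ∑-filter : ∀ {A : Set} (P : A → Bool) L f →
             ∑ (filter (λ x → P x ≟ true) L) f ≡ ∑ L (λ x → b2q (P x) * f x)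
  ∑-filter P [] f = refl
  ∑-filter P (x ∷ L) f with P x
  ... | true = cong₂ _+_ (sym (*-identityˡ (f x))) (∑-filter P L f)
  ... | false = trans (∑-filter P L f) (trans (sym (+-identityˡ _)) (cong (_+ _) (sym (*-zeroˡ (f x)))))

  length-filter : ∀ {A : Set} (P : A → Bool) L →
                  ι (length (filter (λ x → P x ≟ true) L)) ≡ ∑ L (λ x → b2q (P x))
  length-filter P [] = refl
  length-filter P (x ∷ L) with P x
  ... | true = trans (ι-+ 1 _) (cong (1ℚ +_) (length-filter P L))
  ... | false = trans (length-filter P L) (sym (+-identityˡ _))

  filter-nonZero : ∀ {A : Set} (P : A → Bool) {L y} → y ∈ L → P y ≡ true →
                   ℕ.NonZero (length (filter (λ x → P x ≟ true) L))
  filter-nonZero P (here refl) Py rewrite Py = _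
  filter-nonZero P {x ∷ L} (there y∈L) Py with P x
  ... | true = _
  ... | false = filter-nonZero P y∈L Py

  ≤-foldr-⊔ : ∀ {A : Set} (f : A → ℕ) L {y} → y ∈ L → f y ℕ.≤ foldr _⊔_ 0 (map f L)
  ≤-foldr-⊔ f (y ∷ L) (here refl) = ℕP.m≤m⊔n (f y) _
  ≤-foldr-⊔ f (x ∷ L) (there y∈L) = ℕP.≤-trans (≤-foldr-⊔ f L y∈L) (ℕP.m≤n⊔m (f x) _)

  ∈-allVecs : ∀ {n} (x : Vec Bool n) → x ∈ allVecs n
  ∈-allVecs [] = here refl
  ∈-allVecs (false ∷ x) = ∈-++⁺ˡ (∈-map⁺ (false ∷_) (∈-allVecs x))
  ∈-allVecs {suc n} (true ∷ x) = ∈-++⁺ʳ (map (false ∷_) (allVecs n)) (∈-map⁺ (true ∷_) (∈-allVecs x))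

  toggle : ∀ {n} → Fin n → Vec Bool n → Vec Bool n
  toggle zero (b ∷ x) = not b ∷ x
  toggle (suc i) (b ∷ x) = b ∷ toggle i x

  lookup-toggle-same : ∀ {n} (i : Fin n) x → lookup (toggle i x) i ≡ not (lookup x i)
  lookup-toggle-same zero (b ∷ x) = refl
  lookup-toggle-same (suc i) (b ∷ x) = lookup-toggle-same i x

  lookup-toggle-other : ∀ {n} (i j : Fin n) x → j ≢ i → lookup (toggle i x) j ≡ lookup x j
  lookup-toggle-other zero zero (b ∷ x) j≢i = contradiction refl j≢i
  lookup-toggle-other zero (suc j) (b ∷ x) j≢i = refl
  lookup-toggle-other (suc i) zero (b ∷ x) j≢i = refl
  lookup-toggle-other (suc i) (suc j) (b ∷ x) j≢i = lookup-toggle-other i j x (j≢i ∘ cong suc)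

  toggle-involutive : ∀ {n} (i : Fin n) x → toggle i (toggle i x) ≡ x
  toggle-involutive zero (b ∷ x) = cong (_∷ x) (not-involutive b)
  toggle-involutive (suc i) (b ∷ x) = cong (b ∷_) (toggle-involutive i x)

  ∑cube : (n : ℕ) → (Vec Bool n → ℚ) → ℚ
  ∑cube n f = ∑ (allVecs n) f

  ∑cube-suc : ∀ n f → ∑cube (suc n) f ≡ ∑cube n (λ x → f (false ∷ x)) + ∑cube n (λ x → f (true ∷ x))
  ∑cube-suc n f = trans (∑-++ (map (false ∷_) (allVecs n)) (map (true ∷_) (allVecs n)) f)
                        (cong₂ _+_ (∑-map (false ∷_) (allVecs n) f) (∑-map (true ∷_) (allVecs n) f))

  -- Toggling a coordinate permutes the cube, so it does not change sums over it.
  ∑cube-toggle : ∀ n (i : Fin n) f → ∑cube n (f ∘ toggle i) ≡ ∑cube n f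
  ∑cube-toggle (suc n) zero f = begin
      ∑cube (suc n) (f ∘ toggle zero)                              ≡⟨ ∑cube-suc n (f ∘ toggle zero) ⟩
      ∑cube n (λ x → f (true ∷ x)) + ∑cube n (λ x → f (false ∷ x)) ≡⟨ +-comm (∑cube n (λ x → f (true ∷ x))) (∑cube n (λ x → f (false ∷ x))) ⟩
      ∑cube n (λ x → f (false ∷ x)) + ∑cube n (λ x → f (true ∷ x)) ≡⟨ sym (∑cube-suc n f) ⟩
      ∑cube (suc n) f                                              ∎
    where open ≡-Reasoning
  ∑cube-toggle (suc n) (suc i) f = begin
      ∑cube (suc n) (f ∘ toggle (suc i))
        ≡⟨ ∑cube-suc n (f ∘ toggle (suc i)) ⟩
      ∑cube n (λ x → f (false ∷ toggle i x)) + ∑cube n (λ x → f (true ∷ toggle i x))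
        ≡⟨ cong₂ _+_ (∑cube-toggle n i (λ x → f (false ∷ x))) (∑cube-toggle n i (λ x → f (true ∷ x))) ⟩
      ∑cube n (λ x → f (false ∷ x)) + ∑cube n (λ x → f (true ∷ x))
        ≡⟨ sym (∑cube-suc n f) ⟩
      ∑cube (suc n) f ∎
    where open ≡-Reasoning

  #_ : ∀ {n} → (Vec Bool n → Bool) → ℚ
  #_ {n} P = ∑cube n (λ x → b2q (P x))

  #-mono : ∀ {n} {P Q : Vec Bool n → Bool} → (∀ x → P x ≡ true → Q x ≡ true) → # P ≤ # Q
  #-mono {n} P⇒Q = ∑-mono (allVecs n) (λ x → b2q-mono (P⇒Q x))

  #-cong : ∀ {n} {P Q : Vec Bool n → Bool} → (∀ x → P x ≡ Q x) → # P ≡ # Q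
  #-cong {n} P≡Q = ∑-cong (allVecs n) (λ x → cong b2q (P≡Q x))

  #-split : ∀ {n} (j : Fin n) P → # P ≡ # (λ x → P x ∧ not (lookup x j)) + # (λ x → P x ∧ lookup x j)
  #-split {n} j P = trans (∑-cong (allVecs n) (λ x → b2q-split (P x) (lookup x j))) (∑-+ (allVecs n) _ _)

  #-toggle : ∀ {n} (j : Fin n) P → # P ≡ # (λ x → P (toggle j x))
  #-toggle {n} j P = sym (∑cube-toggle n j (λ x → b2q (P x)))

  _⊆_ : ∀ {n} → Vec Bool n → Vec Bool n → Set
  y ⊆ x = ∀ a → lookup y a ≡ true → lookup x a ≡ true

  DownClosed : ∀ {n} → (Vec Bool n → Bool) → Set
  DownClosed P = ∀ x y → y ⊆ x → P x ≡ true → P y ≡ true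

  ⊆-toggle : ∀ {n} (j : Fin n) x → lookup x j ≡ false → x ⊆ toggle j x
  ⊆-toggle j x xⱼ a xₐ with a Fin.≟ j
  ... | yes refl = contradiction (trans (sym xⱼ) xₐ) (λ ())
  ... | no a≢j = trans (lookup-toggle-other j a x a≢j) xₐ

  DownClosed-force : ∀ {n} {P : Vec Bool n → Bool} → DownClosed P → ∀ j → DownClosed (λ x → P x ∧ not (lookup x j))
  DownClosed-force {P = P} down j x y y⊆x e =
    cong₂ _∧_ (down x y y⊆x (∧-conicalˡ (P x) (not (lookup x j)) e)) yⱼ
    where
    yⱼ : not (lookup y j) ≡ true
    yⱼ with lookup y j in y-has-j
    ... | false = refl
    ... | true = contradiction (trans (sym (cong not (y⊆x j y-has-j))) (∧-conicalʳ (P x) _ e)) (λ ())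

  -- Halving lemma: toggling j maps the members of a down-closed family that
  -- contain j injectively to members that do not.
  halving : ∀ {n} {P : Vec Bool n → Bool} → DownClosed P → ∀ j →
            # P ≤ # (λ x → P x ∧ not (lookup x j)) + # (λ x → P x ∧ not (lookup x j))
  halving {P = P} down j = begin
      # P                                                    ≡⟨ #-split j P ⟩
      #P₀ + # (λ x → P x ∧ lookup x j)                        ≡⟨ cong (#P₀ +_) (#-toggle j (λ x → P x ∧ lookup x j)) ⟩
      #P₀ + # (λ x → P (toggle j x) ∧ lookup (toggle j x) j)  ≤⟨ +-monoʳ-≤ #P₀ (#-mono shrink) ⟩
      #P₀ + #P₀                                              ∎
    where
    open ≤-Reasoning
    #P₀ : ℚ
    #P₀ = # (λ x → P x ∧ not (lookup x j))
    shrink : ∀ x → (P (toggle j x) ∧ lookup (toggle j x) j) ≡ true → (P x ∧ not (lookup x j)) ≡ true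
    shrink x e = cong₂ _∧_ (down (toggle j x) x (⊆-toggle j x xⱼ) (∧-conicalˡ (P (toggle j x)) _ e)) (cong not xⱼ)
      where
      xⱼ : lookup x j ≡ false
      xⱼ = not-injective (trans (sym (lookup-toggle-same j x)) (∧-conicalʳ (P (toggle j x)) _ e))

  vanishOn : ∀ {n} → List (Fin n) → Vec Bool n → Bool
  vanishOn [] x = true
  vanishOn (j ∷ L) x = not (lookup x j) ∧ vanishOn L x

  vanishOn-∈ : ∀ {n} {L} {x : Vec Bool n} {j} → vanishOn L x ≡ true → j ∈ L → lookup x j ≡ false
  vanishOn-∈ v (here refl) = not-injective (∧-conicalˡ _ _ v)
  vanishOn-∈ v (there j∈L) = vanishOn-∈ (∧-conicalʳ _ _ v) j∈L

  iterated-halving : ∀ {n} {P : Vec Bool n → Bool} → DownClosed P → ∀ L →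
                     # P ≤ ι (2 ^ length L) * # (λ x → P x ∧ vanishOn L x)
  iterated-halving {P = P} down [] =
    ≤-reflexive (sym (trans (*-identityˡ _) (#-cong (λ x → ∧-identityʳ (P x)))))
  iterated-halving {P = P} down (j ∷ L) = begin
      # P                                  ≤⟨ halving down j ⟩
      # P₀ + # P₀                          ≤⟨ +-mono-≤ forced forced ⟩
      X * C + X * C                        ≡⟨ sym (*-distribʳ-+ C X X) ⟩
      (X + X) * C                          ≡⟨ cong (_* C) (sym (ι-double (length L))) ⟩
      ι (2 ^ suc (length L)) * C           ≡⟨ cong (ι (2 ^ suc (length L)) *_) (#-cong (λ x → ∧-assoc (P x) _ _)) ⟩
      ι (2 ^ length (j ∷ L)) * # (λ x → P x ∧ vanishOn (j ∷ L) x) ∎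
    where
    open ≤-Reasoning
    P₀ : Vec Bool _ → Bool
    P₀ x = P x ∧ not (lookup x j)
    X C : ℚ
    X = ι (2 ^ length L)
    C = # (λ x → P₀ x ∧ vanishOn L x)
    forced : # P₀ ≤ X * C
    forced = iterated-halving (DownClosed-force {P = P} down j) L

  all-intro : ∀ {A : Set} (g : A → Bool) L → (∀ y → g y ≡ true) → foldr _∧_ true (map g L) ≡ true
  all-intro g [] all-g = refl
  all-intro g (y ∷ L) all-g rewrite all-g y = all-intro g L all-g

  all-elim : ∀ {A : Set} (g : A → Bool) L → foldr _∧_ true (map g L) ≡ true → ∀ {y} → y ∈ L → g y ≡ true
  all-elim g (y ∷ L) e (here refl) = ∧-conicalˡ _ _ e
  all-elim g (y ∷ L) e (there y∈L) = all-elim g L (∧-conicalʳ _ _ e) y∈L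

  degree≤maxDegree : ∀ {p} (G : Graph p) i → degree G i ℕ.≤ maxDegree G
  degree≤maxDegree {p} G i = ≤-foldr-⊔ (degree G) (allFin p) (∈-allFin i)

  module IndependentSets {p : ℕ} (G : Graph p) where

    Independent : Vec Bool p → Set
    Independent x = ∀ a b → (adj G a b ∧ lookup x a ∧ lookup x b) ≡ false

    isIndep⇒Independent : ∀ x → isIndep G x ≡ true → Independent x
    isIndep⇒Independent x e a b =
      not-injective (all-elim _ (allFin p) (all-elim _ (allFin p) e (∈-allFin a)) (∈-allFin b))

    Independent⇒isIndep : ∀ x → Independent x → isIndep G x ≡ true
    Independent⇒isIndep x indep =
      all-intro _ (allFin p) (λ a → all-intro _ (allFin p) (λ b → cong not (indep a b)))

    independent-downClosed : DownClosed (isIndep G)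
    independent-downClosed x y y⊆x e = Independent⇒isIndep y shrunk
      where
      shrunk : Independent y
      shrunk a b with lookup y a in y-has-a | lookup y b in y-has-b
      ... | false | _ = ∧-zeroʳ _
      ... | true | false = ∧-zeroʳ _
      ... | true | true = subst₂ (λ u v → (adj G a b ∧ u ∧ v) ≡ false) (y⊆x a y-has-a) (y⊆x b y-has-b)
                                 (isIndep⇒Independent x e a b)

    empty-independent : isIndep G (replicate p false) ≡ true
    empty-independent = Independent⇒isIndep (replicate p false) λ a b →
      trans (cong (λ u → adj G a b ∧ u ∧ lookup (replicate p false) b) (lookup-replicate a false))
            (∧-zeroʳ (adj G a b))

    neighbours : Fin p → List (Fin p)
    neighbours i = filter (λ j → adj G i j ≟ true) (allFin p)

    N : ℕ
    N = length (indepSets G)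

    A : Fin p → ℕ
    A j = length (filter (λ x → lookup x j ≟ true) (indepSets G))

    instance
      N-nonZero : ℕ.NonZero N
      N-nonZero = filter-nonZero (isIndep G) (∈-allVecs (replicate p false)) empty-independent

    ∑I : (Vec Bool p → ℚ) → ℚ
    ∑I f = ∑ (indepSets G) f

    ∑I-cube : ∀ f → ∑I f ≡ ∑cube p (λ x → b2q (isIndep G x) * f x)
    ∑I-cube f = ∑-filter (isIndep G) (allVecs p) f

    ι-N : ι N ≡ # isIndep G
    ι-N = length-filter (isIndep G) (allVecs p)

    ι-A : ∀ j → ι (A j) ≡ ∑I (λ x → b2q (lookup x j))
    ι-A j = length-filter (λ x → lookup x j) (indepSets G)

    module _ (i : Fin p) where

      avoids-neighbours : ∀ y → vanishOn (neighbours i) y ≡ true → ∀ j → adj G i j ≡ true → lookup y j ≡ false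
      avoids-neighbours y avoid j i~j = vanishOn-∈ avoid (∈-filter⁺ (λ k → adj G i k ≟ true) (∈-allFin j) i~j)

      toggle-independent : ∀ y → Independent y → vanishOn (neighbours i) y ≡ true → Independent (toggle i y)
      toggle-independent y indep avoid a b with a Fin.≟ i | b Fin.≟ i
      ... | yes refl | yes refl rewrite irrefl G a = refl
      ... | yes refl | no b≢i with adj G a b in a~b
      ...   | false = refl
      ...   | true rewrite lookup-toggle-other a b y b≢i | avoids-neighbours y avoid b a~b = ∧-zeroʳ _
      toggle-independent y indep avoid a b | no a≢i | yes refl with adj G a b in a~b
      ...   | false = refl
      ...   | true rewrite lookup-toggle-other b a y a≢i
                         | avoids-neighbours y avoid a (trans (Graph.sym G b a) a~b) = refl
      toggle-independent y indep avoid a b | no a≢i | no b≢i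
        rewrite lookup-toggle-other i a y a≢i | lookup-toggle-other i b y b≢i = indep a b

      containing : Vec Bool p → Bool
      containing x = isIndep G x ∧ lookup x i

      avoiding : Vec Bool p → Bool
      avoiding x = isIndep G x ∧ vanishOn (neighbours i) x

      -- Toggling i sends the avoiding sets without i into the sets containing i.
      avoiding-bound : # avoiding ≤ # containing + # containing
      avoiding-bound = begin
          # avoiding
            ≡⟨ #-split i avoiding ⟩
          # (λ x → avoiding x ∧ not (lookup x i)) + # (λ x → avoiding x ∧ lookup x i)
            ≡⟨ cong (_+ # (λ x → avoiding x ∧ lookup x i)) (#-toggle i (λ x → avoiding x ∧ not (lookup x i))) ⟩
          # (λ x → avoiding (toggle i x) ∧ not (lookup (toggle i x) i)) + # (λ x → avoiding x ∧ lookup x i)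
            ≤⟨ +-mono-≤ (#-mono added) (#-mono kept) ⟩
          # containing + # containing ∎
        where
        open ≤-Reasoning
        added : ∀ x → (avoiding (toggle i x) ∧ not (lookup (toggle i x) i)) ≡ true → containing x ≡ true
        added x e = cong₂ _∧_ x-independent x-has-i
          where
          y-avoiding : avoiding (toggle i x) ≡ true
          y-avoiding = ∧-conicalˡ (avoiding (toggle i x)) (not (lookup (toggle i x) i)) e
          x-independent : isIndep G x ≡ true
          x-independent = subst (λ z → isIndep G z ≡ true) (toggle-involutive i x)
            (Independent⇒isIndep (toggle i (toggle i x)) (toggle-independent (toggle i x)
              (isIndep⇒Independent (toggle i x) (∧-conicalˡ (isIndep G (toggle i x)) avoid-nbrs y-avoiding))
              (∧-conicalʳ (isIndep G (toggle i x)) avoid-nbrs y-avoiding)))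
            where
            avoid-nbrs : Bool
            avoid-nbrs = vanishOn (neighbours i) (toggle i x)
          x-has-i : lookup x i ≡ true
          x-has-i = trans (sym (not-involutive (lookup x i)))
                          (trans (cong not (sym (lookup-toggle-same i x))) (∧-conicalʳ (avoiding (toggle i x)) _ e))
        kept : ∀ x → (avoiding x ∧ lookup x i) ≡ true → containing x ≡ true
        kept x e = cong₂ _∧_ (∧-conicalˡ (isIndep G x) (vanishOn (neighbours i) x) (∧-conicalˡ (avoiding x) (lookup x i) e))
                             (∧-conicalʳ (avoiding x) (lookup x i) e)

      count-bound : N ℕ.≤ 2 ^ suc (degree G i) ℕ.* A i
      count-bound = ι-reflects-≤ (begin
          ι N                                    ≡⟨ ι-N ⟩
          # isIndep G                            ≤⟨ iterated-halving independent-downClosed (neighbours i) ⟩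
          X * # avoiding                         ≤⟨ *-monoˡ-≤-nonNeg X {{ι-nonNeg _}} avoiding-bound ⟩
          X * (# containing + # containing)      ≡⟨ *-distribˡ-+ X (# containing) (# containing) ⟩
          X * # containing + X * # containing    ≡⟨ sym (*-distribʳ-+ (# containing) X X) ⟩
          (X + X) * # containing                 ≡⟨ cong₂ _*_ (sym (ι-double (degree G i))) (sym ι-A-cube) ⟩
          ι (2 ^ suc (degree G i)) * ι (A i)     ≡⟨ sym (ι-* (2 ^ suc (degree G i)) (A i)) ⟩
          ι (2 ^ suc (degree G i) ℕ.* A i)       ∎)
        where
        open ≤-Reasoning
        X : ℚ
        X = ι (2 ^ degree G i)
        ι-A-cube : ι (A i) ≡ # containing
        ι-A-cube = trans (ι-A i) (trans (∑I-cube _)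
                     (∑-cong (allVecs p) (λ x → sym (b2q-∧ (isIndep G x) (lookup x i)))))

    μ : Fin p → ℚ
    μ = meanParam0 G

    u : ℚ
    u = frac 1 N

    uniform-marginal : ∀ j → u * ∑I (λ x → b2q (lookup x j)) ≡ μ j
    uniform-marginal j = trans (cong (u *_) (sym (ι-A j))) (reciprocal-* (A j) N)

    uniform-mass : u * ∑I (λ _ → 1ℚ) ≡ 1ℚ
    uniform-mass = trans (cong (u *_) (trans (∑-const (indepSets G) 1ℚ) (*-identityˡ (ι N))))
                         (frac-*-denominator 1 N)

    μ-in-M : InMarginalPolytope G μ
    μ-in-M = (λ _ → u) , (λ _ → frac-nonneg 1 N) , mass , marginals
      where
      mass : ∑I (λ _ → u) ≡ 1ℚ
      mass = trans (∑-cong (indepSets G) (λ _ → sym (*-identityʳ u)))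
                   (trans (∑-*ˡ (indepSets G) u (λ _ → 1ℚ)) uniform-mass)
      marginals : ∀ j → ∑I (λ x → u * b2q (lookup x j)) ≡ μ j
      marginals j = trans (∑-*ˡ (indepSets G) u _) (uniform-marginal j)

    -- Every x ∌ i with x ∪ {i} independent (a donor) moves mass c from x to x ∪ {i}.
    module Perturbation (i : Fin p) (c : ℚ) where

      donor : Vec Bool p → ℚ
      donor x = b2q (isIndep G (toggle i x) ∧ not (lookup x i))

      weight : Vec Bool p → ℚ
      weight x = u + c * (b2q (lookup x i) - donor x)

      donor⇒independent : ∀ x → (isIndep G (toggle i x) ∧ not (lookup x i)) ≡ true → isIndep G x ≡ true
      donor⇒independent x e =
        independent-downClosed (toggle i x) x (⊆-toggle i x (not-injective (∧-conicalʳ (isIndep G (toggle i x)) _ e)))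
                               (∧-conicalˡ (isIndep G (toggle i x)) (not (lookup x i)) e)

      transfer : ∀ (h : Vec Bool p → ℚ) → ∑I (λ x → donor x * h x) ≡ ∑I (λ x → b2q (lookup x i) * h (toggle i x))
      transfer h = begin
          ∑I (λ x → donor x * h x)                                ≡⟨ ∑I-cube _ ⟩
          ∑cube p (λ x → b2q (isIndep G x) * (donor x * h x))     ≡⟨ ∑-cong (allVecs p) donors-independent ⟩
          ∑cube p (λ x → donor x * h x)                           ≡⟨ ∑-cong (allVecs p) reindex ⟩
          ∑cube p (f ∘ toggle i)                                  ≡⟨ ∑cube-toggle p i f ⟩
          ∑cube p f                                               ≡⟨ ∑-cong (allVecs p) split ⟩
          ∑cube p (λ x → b2q (isIndep G x) * (b2q (lookup x i) * h (toggle i x))) ≡⟨ sym (∑I-cube _) ⟩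
          ∑I (λ x → b2q (lookup x i) * h (toggle i x))            ∎
        where
        open ≡-Reasoning
        f : Vec Bool p → ℚ
        f y = b2q (isIndep G y ∧ lookup y i) * h (toggle i y)
        donors-independent : ∀ x → b2q (isIndep G x) * (donor x * h x) ≡ donor x * h x
        donors-independent x = trans (sym (*-assoc (b2q (isIndep G x)) (donor x) (h x)))
                                     (cong (_* h x) (b2q-absorb (donor⇒independent x)))
        reindex : ∀ x → donor x * h x ≡ f (toggle i x)
        reindex x = cong₂ (λ (b : Bool) (z : Vec Bool p) → b2q (isIndep G (toggle i x) ∧ b) * h z)
                          (sym (lookup-toggle-same i x)) (sym (toggle-involutive i x))
        split : ∀ x → f x ≡ b2q (isIndep G x) * (b2q (lookup x i) * h (toggle i x))
        split x = trans (cong (_* h (toggle i x)) (b2q-∧ (isIndep G x) (lookup x i)))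
                        (*-assoc (b2q (isIndep G x)) (b2q (lookup x i)) (h (toggle i x)))

      weight-moment : ∀ (y : Vec Bool p → ℚ) → ∑I (λ x → weight x * y x) ≡
        u * ∑I y + c * (∑I (λ x → b2q (lookup x i) * y x) - ∑I (λ x → b2q (lookup x i) * y (toggle i x)))
      weight-moment y = begin
          ∑I (λ x → weight x * y x)
            ≡⟨ ∑-cong (indepSets G) expand ⟩
          ∑I (λ x → u * y x + c * (b2q (lookup x i) * y x - donor x * y x))
            ≡⟨ ∑-+ (indepSets G) _ _ ⟩
          ∑I (λ x → u * y x) + ∑I (λ x → c * (b2q (lookup x i) * y x - donor x * y x))
            ≡⟨ cong₂ _+_ (∑-*ˡ (indepSets G) u y) (∑-*ˡ (indepSets G) c _) ⟩
          u * ∑I y + c * ∑I (λ x → b2q (lookup x i) * y x - donor x * y x)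
            ≡⟨ cong (λ z → u * ∑I y + c * z) (∑-- (indepSets G) _ _) ⟩
          u * ∑I y + c * (∑I (λ x → b2q (lookup x i) * y x) - ∑I (λ x → donor x * y x))
            ≡⟨ cong (λ z → u * ∑I y + c * (∑I (λ x → b2q (lookup x i) * y x) - z)) (transfer y) ⟩
          u * ∑I y + c * (∑I (λ x → b2q (lookup x i) * y x) - ∑I (λ x → b2q (lookup x i) * y (toggle i x))) ∎
        where
        open ≡-Reasoning
        open +-*-Solver
        expand : ∀ x → weight x * y x ≡ u * y x + c * (b2q (lookup x i) * y x - donor x * y x)
        expand x = solve 5 (λ u c b d y → (u :+ c :* (b :- d)) :* y := u :* y :+ c :* (b :* y :- d :* y))
                           refl u c (b2q (lookup x i)) (donor x) (y x)

      no-net-change : ∀ T → c * (T - T) ≡ 0ℚ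
      no-net-change T = trans (cong (c *_) (+-inverseʳ T)) (*-zeroʳ c)

      weight-mass : ∑I weight ≡ 1ℚ
      weight-mass = begin
          ∑I weight                        ≡⟨ ∑-cong (indepSets G) (λ x → sym (*-identityʳ (weight x))) ⟩
          ∑I (λ x → weight x * 1ℚ)         ≡⟨ weight-moment (λ _ → 1ℚ) ⟩
          u * ∑I (λ _ → 1ℚ) + c * (T - T)  ≡⟨ cong₂ _+_ uniform-mass (no-net-change T) ⟩
          1ℚ + 0ℚ                          ≡⟨ +-identityʳ 1ℚ ⟩
          1ℚ                               ∎
        where
        open ≡-Reasoning
        T : ℚ
        T = ∑I (λ x → b2q (lookup x i) * 1ℚ)

      weight-marginal : ∀ j → ∑I (λ x → weight x * b2q (lookup x j)) ≡ addAt μ (c * ι (A i)) i j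
      weight-marginal j with j Fin.≟ i
      ... | yes refl = begin
          ∑I (λ x → weight x * b2q (lookup x i))
            ≡⟨ weight-moment (λ x → b2q (lookup x i)) ⟩
          u * S + c * (∑I (λ x → b2q (lookup x i) * b2q (lookup x i))
                       - ∑I (λ x → b2q (lookup x i) * b2q (lookup (toggle i x) i)))
            ≡⟨ cong₂ (λ s t → u * S + c * (s - t)) (∑-cong (indepSets G) (λ x → b2q-idem (lookup x i)))
                     (∑-zero (indepSets G) toggled-misses-i) ⟩
          u * S + c * (S - 0ℚ)
            ≡⟨ cong₂ (λ s t → s + c * t) (uniform-marginal i) (trans (+-identityʳ S) (sym (ι-A i))) ⟩
          μ i + c * ι (A i) ∎
        where
        open ≡-Reasoning
        S : ℚ
        S = ∑I (λ x → b2q (lookup x i))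
        toggled-misses-i : ∀ x → b2q (lookup x i) * b2q (lookup (toggle i x) i) ≡ 0ℚ
        toggled-misses-i x = trans (cong (λ b → b2q (lookup x i) * b2q b) (lookup-toggle-same i x))
                                   (b2q-complement (lookup x i))
      ... | no j≢i = begin
          ∑I (λ x → weight x * b2q (lookup x j))
            ≡⟨ weight-moment (λ x → b2q (lookup x j)) ⟩
          u * ∑I (λ x → b2q (lookup x j)) + c * (T - ∑I (λ x → b2q (lookup x i) * b2q (lookup (toggle i x) j)))
            ≡⟨ cong (λ t → u * ∑I (λ x → b2q (lookup x j)) + c * (T - t))
                    (∑-cong (indepSets G) (λ x → cong (λ b → b2q (lookup x i) * b2q b) (lookup-toggle-other i j x j≢i))) ⟩
          u * ∑I (λ x → b2q (lookup x j)) + c * (T - T)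
            ≡⟨ cong₂ _+_ (uniform-marginal j) (no-net-change T) ⟩
          μ j + 0ℚ
            ≡⟨ +-identityʳ (μ j) ⟩
          μ j ∎
        where
        open ≡-Reasoning
        T : ℚ
        T = ∑I (λ x → b2q (lookup x i) * b2q (lookup x j))

      weight-nonneg : 0ℚ ≤ c → c ≤ u → ∀ x → 0ℚ ≤ weight x
      weight-nonneg 0≤c c≤u x = begin
          0ℚ             ≡⟨ sym (+-inverseʳ c) ⟩
          c - c          ≤⟨ +-monoˡ-≤ (- c) c≤u ⟩
          u - c          ≡⟨ cong (u +_) (trans (cong -_ (sym (*-identityʳ c))) (neg-distribʳ-* c 1ℚ)) ⟩
          u + c * - 1ℚ   ≤⟨ +-monoʳ-≤ u (*-monoˡ-≤-nonNeg c {{ℚ.nonNegative 0≤c}}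
                                           (b2q-difference (lookup x i) (isIndep G (toggle i x)))) ⟩
          weight x       ∎
        where open ≤-Reasoning

      perturbed-in-M : 0ℚ ≤ c → c ≤ u → InMarginalPolytope G (addAt μ (c * ι (A i)) i)
      perturbed-in-M 0≤c c≤u = weight , weight-nonneg 0≤c c≤u , weight-mass , weight-marginal

  theorem : ∀ {p} (G : Graph p) → 2 ^ suc (maxDegree G) ℕ.≤ p →
            InM1 G (invPowℚ p 8) (powℚ p 5) (meanParam0 G)
  theorem {p} G 2^Δ+1≤p = μ-in-M , lower-bound , shifted-in-M
    where
    open IndependentSets G

    instance
      p-nonZero : ℕ.NonZero p
      p-nonZero = ℕ.>-nonZero (ℕP.<-≤-trans (ℕP.m^n>0 2 (suc (maxDegree G))) 2^Δ+1≤p)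
      p⁸-nonZero : ℕ.NonZero (p ^ 8)
      p⁸-nonZero = ℕP.m^n≢0 p 8

    N≤pA : ∀ i → N ℕ.≤ p ℕ.* A i
    N≤pA i = ℕP.≤-trans (count-bound i)
      (ℕP.*-monoˡ-≤ (A i) (ℕP.≤-trans (ℕP.^-monoʳ-≤ 2 (ℕ.s≤s (degree≤maxDegree G i))) 2^Δ+1≤p))

    A-nonZero : ∀ i → ℕ.NonZero (A i)
    A-nonZero i = ℕ.≢-nonZero λ Aᵢ≡0 → ℕ.≢-nonZero⁻¹ N (ℕP.n≤0⇒n≡0
      (ℕP.≤-trans (N≤pA i) (ℕP.≤-reflexive (trans (cong (p ℕ.*_) Aᵢ≡0) (ℕP.*-zeroʳ p)))))

    lower-bound : ∀ i → powℚ p 5 * invPowℚ p 8 ≤ μ i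
    lower-bound i = begin
        powℚ p 5 * invPowℚ p 8      ≡⟨ cong (_* invPowℚ p 8) (frac-one (p ^ 5)) ⟩
        ι (p ^ 5) * frac 1 (p ^ 8)  ≡⟨ *-comm (ι (p ^ 5)) (frac 1 (p ^ 8)) ⟩
        frac 1 (p ^ 8) * ι (p ^ 5)  ≡⟨ reciprocal-* (p ^ 5) (p ^ 8) ⟩
        frac (p ^ 5) (p ^ 8)        ≤⟨ frac-≤ (p ^ 5) (p ^ 8) 1 p p⁵·p≤p⁸ ⟩
        frac 1 p                    ≤⟨ frac-≤ 1 p (A i) N N≤Aᵢ·p ⟩
        μ i                         ∎
      where
      open ≤-Reasoning
      p⁵·p≤p⁸ : p ^ 5 ℕ.* p ℕ.≤ 1 ℕ.* p ^ 8
      p⁵·p≤p⁸ = subst₂ ℕ._≤_ (ℕP.*-comm p (p ^ 5)) (sym (ℕP.*-identityˡ (p ^ 8)))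
                              (ℕP.^-monoʳ-≤ p (ℕP.m≤m+n 6 2))
      N≤Aᵢ·p : 1 ℕ.* N ℕ.≤ A i ℕ.* p
      N≤Aᵢ·p = subst₂ ℕ._≤_ (sym (ℕP.*-identityˡ N)) (ℕP.*-comm p (A i)) (N≤pA i)

    -- Shift mass c = 1/(p⁸Aᵢ) per donor: c·Aᵢ = ε, and c ≤ 1/N since N ≤ p⁸Aᵢ.
    shifted-in-M : ∀ i → InMarginalPolytope G (addAt μ (invPowℚ p 8) i)
    shifted-in-M i = subst (λ e → InMarginalPolytope G (addAt μ e i))
                           (reciprocal-cancel (A i) (p ^ 8))
                           (perturbed-in-M (frac-nonneg 1 (p ^ 8 ℕ.* A i)) c≤u)
      where
      instance
        Aᵢ-nonZero : ℕ.NonZero (A i)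
        Aᵢ-nonZero = A-nonZero i
      open Perturbation i (frac 1 (p ^ 8 ℕ.* A i))
      N≤p⁸Aᵢ : 1 ℕ.* N ℕ.≤ 1 ℕ.* (p ^ 8 ℕ.* A i)
      N≤p⁸Aᵢ = subst₂ ℕ._≤_ (sym (ℕP.*-identityˡ N)) (sym (ℕP.*-identityˡ _))
        (ℕP.≤-trans (N≤pA i) (ℕP.*-monoˡ-≤ (A i) (ℕP.m≤m*n p (p ^ 7) {{ℕP.m^n≢0 p 7}})))
      c≤u : frac 1 (p ^ 8 ℕ.* A i) ≤ u
      c≤u = frac-≤ 1 (p ^ 8 ℕ.* A i) 1 N {{ℕP.m*n≢0 (p ^ 8) (A i)}} N≤p⁸Aᵢ

open import Defs
open import Data.Nat using (ℕ; _≤_; _^_; _+_)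
open import Data.Nat.Properties using (+-comm)
open import Data.Product using (Σ; _,_)
open import Relation.Binary.PropositionalEquality using (_≡_; refl; subst)
open HardCore using (theorem)

lemma1 : Σ ℕ λ C → (d p : ℕ) → (G : Graph p) → maxDegree G ≡ d → 2 ^ (d + 1) ≤ p → C ≤ p
           → InM1 G (invPowℚ p 8) (powℚ p 5) (meanParam0 G)
lemma1 = 0 , λ { d p G refl 2^d+1≤p _ → theorem G (subst (λ k → 2 ^ k ≤ p) (+-comm d 1) 2^d+1≤p) }
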